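{- For every integer $n\ge2$, $\gamma_{tr3}(P_2\square P_n)=2n$.
   Context: $P_m$ denotes the directed path with vertex set $\{0,1,\dots,m-1\}$ and arcs $(i,i+1)$ for $0\le i\le m-2$. The Cartesian product $D_1\square D_2$ has vertex set $V(D_1)\times V(D_2)$, with an arc from $(x_1,y_1)$ to $(x_2,y_2)$ iff either $(x_1,x_2)$ is an arc of $D_1$ and $y_1=y_2$, or $x_1=x_2$ and $(y_1,y_2)$ is an arc of $D_2$. For a digraph $D$ and positive integer $k$, a $k$RDF is a function $f:V(D)\to\mathcal{P}(\{1,\dots,k\})$ such that every $v$ with $f(v)=\emptyset$ satisfies $\bigcup_{u\in N^-(v)}f(u)=\{1,\dots,k\}$ ($N^-(v)$ the in-neighbors of $v$); its weight is $\sum_v|f(v)|$. For $D$ with no isolated vertex, a T$k$RDF is a $k$RDF $f$ such that the subdigraph induced by $\{v:f(v)\neq\emptyset\}$ has no isolated vertex (a vertex with no in- or out-neighbors in it); $\gamma_{trk}(D)$ is the minimum weight of a T$k$RDF. -}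

module Defs where

open import Data.Nat using (ℕ; suc; _*_)
open import Data.Fin using (Fin; toℕ; remQuot)
open import Data.Fin.Subset using (Subset; _∈_; ∣_∣; Nonempty; Empty)
open import Data.Product using (_×_; _,_; ∃; proj₁; proj₂)
open import Data.Sum using (_⊎_)
open import Data.Vec using (tabulate; sum)
open import Relation.Binary.PropositionalEquality using (_≡_)

record Digraph : Set₁ where
  field
    size : ℕ
    Arc  : Fin size → Fin size → Set
open Digraph public

P : ℕ → Digraph
P m = record { size = m ; Arc = λ i j → toℕ j ≡ suc (toℕ i) }

-- Cartesian product; vertex (x , y) of V(D1) × V(D2) is encoded as
-- combine x y : Fin (size D1 * size D2), decoded by remQuot.
_□_ : Digraph → Digraph → Digraph
D₁ □ D₂ = record
  { size = size D₁ * size D₂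
  ; Arc  = λ a b →
      let p = remQuot (size D₂) a ; q = remQuot (size D₂) b in
      (Arc D₁ (proj₁ p) (proj₁ q) × proj₂ p ≡ proj₂ q)
      ⊎ (proj₁ p ≡ proj₁ q × Arc D₂ (proj₂ p) (proj₂ q))
  }

Labeling : Digraph → ℕ → Set
Labeling D k = Fin (size D) → Subset k

weight : (D : Digraph) (k : ℕ) → Labeling D k → ℕ
weight D k f = sum (tabulate (λ v → ∣ f v ∣))

IsRDF : (D : Digraph) (k : ℕ) → Labeling D k → Set
IsRDF D k f = ∀ v → Empty (f v) →
  ∀ (c : Fin k) → ∃ λ u → Arc D u v × c ∈ f u

IsTRDF : (D : Digraph) (k : ℕ) → Labeling D k → Set
IsTRDF D k f = IsRDF D k f ×
  (∀ v → Nonempty (f v) →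
     ∃ λ u → Nonempty (f u) × (Arc D u v ⊎ Arc D v u))

γtr≡ : (D : Digraph) (k : ℕ) → ℕ → Set
γtr≡ D k m =
  (∃ λ f → IsTRDF D k f × weight D k f ≡ m) ×
  (∀ f → IsTRDF D k f → m Data.Nat.≤ weight D k f)

-- Labelling every vertex with {1} is a total 3RDF of weight 2n, because (0 , y) → (1 , y)
-- is an arc.  The lower bound holds for every 3RDF.  Write a_y and b_y for the label sizes
-- at (0 , y) and (1 , y).  The only in-neighbour of (0 , y+1) is (0 , y), and those of
-- (1 , y+1) are (0 , y+1) and (1 , y); so a_{y+1} = 0 forces a_y = 3, and b_{y+1} = 0 forces
-- a_{y+1} + b_y ≥ 3.  Moreover (0 , 0) is a source, so a_0 ≥ 1, and b_0 = 0 forces a_0 = 3.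
-- Thus a light column is paid for by the column before it.  By induction from the last
-- column, the weight of the columns from y onwards plus a correction slack a_y b_y, which
-- vanishes unless column y leans on column y - 1, is at least twice their number; at y = 0
-- the correction vanishes.
module Submission where

open import Defs
open import Data.Nat using (ℕ; zero; suc; _+_; _*_; _≤_; z≤n; s≤s; s≤s⁻¹)
open import Data.Nat.Properties
  using ( ≤-refl; ≤-trans; ≤-reflexive; +-mono-≤; +-monoˡ-≤; +-monoʳ-≤; m≤m+n; m≤n+m; n≤1+n
        ; +-identityʳ; *-identityʳ; *-suc; +-suc; +-assoc; suc-injective; module ≤-Reasoning)
open import Data.Nat.Tactic.RingSolver using (solve-∀)
open import Data.Fin as Fin using (Fin; combine; remQuot; inject₁; _↑ˡ_; _↑ʳ_)
open import Data.Fin.Properties using (remQuot-combine; combine-remQuot; toℕ-injective; toℕ-inject₁)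
open import Data.Fin.Subset using (Subset; _∈_; _⊆_; _∪_; ∣_∣; Nonempty; Empty; inside; outside; ⁅_⁆; ⊤)
open import Data.Fin.Subset.Properties
  using (x∈⁅x⁆; x∈⁅y⁆⇒x≡y; p⊆q⇒∣p∣≤∣q∣; ∣⁅x⁆∣≡1; ∣⊤∣≡n; x∈p∪q⁺)
open import Data.Vec using ([]; _∷_; tabulate; sum)
open import Data.Product using (_×_; _,_; ∃; ∃₂; proj₁; proj₂)
open import Data.Sum as Sum using (_⊎_; inj₁; inj₂)
open import Data.Empty using (⊥-elim)
open import Relation.Nullary using (¬_)
open import Function using (_∘_)
open import Relation.Binary.PropositionalEquality
  using (_≡_; _≢_; refl; sym; trans; cong; cong₂; subst; subst₂)

private
  variable
    k n : ℕ

∣p∣≡0⇒Empty : (p : Subset k) → ∣ p ∣ ≡ 0 → Empty p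
∣p∣≡0⇒Empty p ∣p∣≡0 (x , x∈p) = 1≰0 (subst₂ _≤_ (∣⁅x⁆∣≡1 x) ∣p∣≡0 (p⊆q⇒∣p∣≤∣q∣ ⁅x⁆⊆p))
  where
  ⁅x⁆⊆p : ⁅ x ⁆ ⊆ p
  ⁅x⁆⊆p y∈⁅x⁆ = subst (_∈ p) (sym (x∈⁅y⁆⇒x≡y x y∈⁅x⁆)) x∈p
  1≰0 : ¬ 1 ≤ 0
  1≰0 ()

∀∈⇒n≤∣p∣ : (p : Subset n) → (∀ x → x ∈ p) → n ≤ ∣ p ∣
∀∈⇒n≤∣p∣ {n} p full = subst (_≤ ∣ p ∣) (∣⊤∣≡n n) (p⊆q⇒∣p∣≤∣q∣ {p = ⊤} (λ {x} _ → full x))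

∣p∪q∣≤∣p∣+∣q∣ : (p q : Subset n) → ∣ p ∪ q ∣ ≤ ∣ p ∣ + ∣ q ∣
∣p∪q∣≤∣p∣+∣q∣ []            []            = z≤n
∣p∪q∣≤∣p∣+∣q∣ (inside ∷ p)  (inside ∷ q)  =
  s≤s (≤-trans (∣p∪q∣≤∣p∣+∣q∣ p q) (+-monoʳ-≤ ∣ p ∣ (n≤1+n ∣ q ∣)))
∣p∪q∣≤∣p∣+∣q∣ (inside ∷ p)  (outside ∷ q) = s≤s (∣p∪q∣≤∣p∣+∣q∣ p q)
∣p∪q∣≤∣p∣+∣q∣ (outside ∷ p) (inside ∷ q)  =
  ≤-trans (s≤s (∣p∪q∣≤∣p∣+∣q∣ p q)) (≤-reflexive (sym (+-suc ∣ p ∣ ∣ q ∣)))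
∣p∪q∣≤∣p∣+∣q∣ (outside ∷ p) (outside ∷ q) = ∣p∪q∣≤∣p∣+∣q∣ p q

∀∈⊎∈⇒n≤∣p∣+∣q∣ : (p q : Subset n) → (∀ x → x ∈ p ⊎ x ∈ q) → n ≤ ∣ p ∣ + ∣ q ∣
∀∈⊎∈⇒n≤∣p∣+∣q∣ p q cover =
  ≤-trans (∀∈⇒n≤∣p∣ (p ∪ q) (λ x → x∈p∪q⁺ (cover x))) (∣p∪q∣≤∣p∣+∣q∣ p q)

sum-tabulate-↑ : ∀ m n (g : Fin (m + n) → ℕ) →
  sum (tabulate g) ≡ sum (tabulate (λ i → g (i ↑ˡ n))) + sum (tabulate (λ j → g (m ↑ʳ j)))
sum-tabulate-↑ zero    n g = refl
sum-tabulate-↑ (suc m) n g =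
  trans (cong (g Fin.zero +_) (sum-tabulate-↑ m n (g ∘ Fin.suc))) (sym (+-assoc (g Fin.zero) _ _))

sum-tabulate-combine : ∀ m n (g : Fin (m * n) → ℕ) →
  sum (tabulate g) ≡ sum (tabulate (λ x → sum (tabulate (λ y → g (combine {m} {n} x y)))))
sum-tabulate-combine zero    n g = refl
sum-tabulate-combine (suc m) n g =
  trans (sum-tabulate-↑ n (m * n) g)
        (cong (sum (tabulate (λ y → g (y ↑ˡ m * n))) +_) (sum-tabulate-combine m n (λ i → g (n ↑ʳ i))))

sum-tabulate-const : ∀ n c → sum (tabulate {n = n} (λ _ → c)) ≡ n * c
sum-tabulate-const zero    c = refl
sum-tabulate-const (suc n) c = cong (c +_) (sum-tabulate-const n c)

ProductArc : (D₁ D₂ : Digraph) → Fin (size D₁) × Fin (size D₂) → Fin (size D₁) × Fin (size D₂) → Set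
ProductArc D₁ D₂ (x , y) (x' , y') = (Arc D₁ x x' × y ≡ y') ⊎ (x ≡ x' × Arc D₂ y y')

module _ (D₁ D₂ : Digraph) where

  □-arc : ∀ {x x' y y'} → ProductArc D₁ D₂ (x , y) (x' , y') →
          Arc (D₁ □ D₂) (combine x y) (combine x' y')
  □-arc {x} {x'} {y} {y'} =
    subst₂ (ProductArc D₁ D₂) (sym (remQuot-combine x y)) (sym (remQuot-combine x' y'))

  □-in-neighbour : ∀ u x' y' → Arc (D₁ □ D₂) u (combine x' y') →
                   ∃₂ λ x y → u ≡ combine x y × ProductArc D₁ D₂ (x , y) (x' , y')
  □-in-neighbour u x' y' arc =
    proj₁ xy , proj₂ xy , sym (combine-remQuot {size D₁} (size D₂) u) ,
    subst (ProductArc D₁ D₂ xy) (remQuot-combine x' y') arc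
    where
    xy = remQuot {size D₁} (size D₂) u

P-arc⇒≡inject₁ : ∀ {y} {i : Fin n} → Arc (P (suc n)) y (Fin.suc i) → y ≡ inject₁ i
P-arc⇒≡inject₁ {i = i} arc = toℕ-injective (trans (sym (suc-injective arc)) (sym (toℕ-inject₁ i)))

module _ (D : Digraph) {f : Labeling D k} (rdf : IsRDF D k f) where

  private
    in-neighbour-with : ∀ {v} → ∣ f v ∣ ≡ 0 → ∀ c → ∃ λ u → Arc D u v × c ∈ f u
    in-neighbour-with {v} ∣fv∣≡0 = rdf v (∣p∣≡0⇒Empty (f v) ∣fv∣≡0)

  rdf-source : ∀ {v} → (∀ u → ¬ Arc D u v) → Fin k → ∣ f v ∣ ≢ 0
  rdf-source no-arc c ∣fv∣≡0 = no-arc _ (proj₁ (proj₂ (in-neighbour-with ∣fv∣≡0 c)))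

  rdf-sole-in-neighbour : ∀ {v w} → (∀ {u} → Arc D u v → u ≡ w) → ∣ f v ∣ ≡ 0 → k ≤ ∣ f w ∣
  rdf-sole-in-neighbour sole ∣fv∣≡0 = ∀∈⇒n≤∣p∣ _ λ c →
    let (u , arc , c∈fu) = in-neighbour-with ∣fv∣≡0 c in subst ((c ∈_) ∘ f) (sole arc) c∈fu

  rdf-two-in-neighbours : ∀ {v w₁ w₂} → (∀ {u} → Arc D u v → u ≡ w₁ ⊎ u ≡ w₂) → ∣ f v ∣ ≡ 0 →
                          k ≤ ∣ f w₁ ∣ + ∣ f w₂ ∣
  rdf-two-in-neighbours two ∣fv∣≡0 = ∀∈⊎∈⇒n≤∣p∣+∣q∣ _ _ λ c →
    let (u , arc , c∈fu) = in-neighbour-with ∣fv∣≡0 c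
    in Sum.map (λ eq → subst ((c ∈_) ∘ f) eq c∈fu) (λ eq → subst ((c ∈_) ∘ f) eq c∈fu) (two arc)

slack : ℕ → ℕ → ℕ
slack 0             0       = 2
slack 0             (suc _) = 1
slack 1             0       = 1
slack 1             (suc _) = 0
slack (suc (suc _)) _       = 0

slack-base : ∀ a b → 2 ≤ a + b + slack a b
slack-base 0             0       = ≤-refl
slack-base 0             (suc b) = s≤s (m≤n+m 1 b)
slack-base 1             0       = ≤-refl
slack-base 1             (suc b) = s≤s (s≤s z≤n)
slack-base (suc (suc a)) b       = s≤s (s≤s z≤n)

slack-step : ∀ a b c d → (c ≡ 0 → 3 ≤ a) → (d ≡ 0 → 3 ≤ c + b) →
             2 + slack c d ≤ a + b + slack a b
slack-step a       b       0             0       h g =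
  ≤-trans (+-mono-≤ (h refl) (≤-trans (s≤s z≤n) (g refl))) (m≤m+n _ _)
slack-step a       b       0             (suc d) h _ = ≤-trans (h refl) (≤-trans (m≤m+n a b) (m≤m+n _ _))
slack-step 0       0       1             0       _ g with g refl
... | s≤s ()
slack-step 0       (suc b) 1             0       _ g = +-monoˡ-≤ 1 (s≤s⁻¹ (g refl))
slack-step (suc a) b       1             0       _ g =
  s≤s (≤-trans (s≤s⁻¹ (g refl)) (≤-trans (m≤n+m b a) (m≤m+n _ _)))
slack-step a       b       1             (suc d) _ _ = slack-base a b
slack-step a       b       (suc (suc c)) d       _ _ = slack-base a b

slack-first : ∀ a b → a ≢ 0 → (b ≡ 0 → 3 ≤ a) → slack a b ≡ 0
slack-first 0             b       a≢0 _ = ⊥-elim (a≢0 refl)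
slack-first 1             0       _   h with h refl
... | s≤s ()
slack-first 1             (suc b) _   _ = refl
slack-first (suc (suc a)) b       _   _ = refl

columns-bound : ∀ m (α β : Fin (suc m) → ℕ) →
  (∀ i → α (Fin.suc i) ≡ 0 → 3 ≤ α (inject₁ i)) →
  (∀ i → β (Fin.suc i) ≡ 0 → 3 ≤ α (Fin.suc i) + β (inject₁ i)) →
  2 * suc m ≤ sum (tabulate α) + sum (tabulate β) + slack (α Fin.zero) (β Fin.zero)
columns-bound zero α β _ _ = begin
  2                                 ≤⟨ slack-base a b ⟩
  a + b + slack a b                 ≡⟨ cong (_+ slack a b) (sym (cong₂ _+_ (+-identityʳ a) (+-identityʳ b))) ⟩
  (a + 0) + (b + 0) + slack a b     ∎
  where
  open ≤-Reasoning
  a = α Fin.zero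
  b = β Fin.zero
columns-bound (suc m) α β hα hβ = begin
  2 * suc (suc m)                        ≡⟨ *-suc 2 (suc m) ⟩
  2 + 2 * suc m                          ≤⟨ +-monoʳ-≤ 2 tail-bound ⟩
  2 + (Σα + Σβ + slack a₁ b₁)            ≡⟨ rearrange₁ 2 Σα Σβ (slack a₁ b₁) ⟩
  (2 + slack a₁ b₁) + (Σα + Σβ)          ≤⟨ +-monoˡ-≤ (Σα + Σβ) (slack-step a₀ b₀ a₁ b₁ (hα Fin.zero) (hβ Fin.zero)) ⟩
  (a₀ + b₀ + slack a₀ b₀) + (Σα + Σβ)    ≡⟨ rearrange₂ a₀ b₀ (slack a₀ b₀) Σα Σβ ⟩
  (a₀ + Σα) + (b₀ + Σβ) + slack a₀ b₀    ∎
  where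
  open ≤-Reasoning
  a₀ = α Fin.zero
  b₀ = β Fin.zero
  a₁ = α (Fin.suc Fin.zero)
  b₁ = β (Fin.suc Fin.zero)
  Σα = sum (tabulate (α ∘ Fin.suc))
  Σβ = sum (tabulate (β ∘ Fin.suc))
  tail-bound : 2 * suc m ≤ Σα + Σβ + slack a₁ b₁
  tail-bound = columns-bound m (α ∘ Fin.suc) (β ∘ Fin.suc) (hα ∘ Fin.suc) (hβ ∘ Fin.suc)
  rearrange₁ : ∀ x s t e → x + (s + t + e) ≡ (x + e) + (s + t)
  rearrange₁ = solve-∀
  rearrange₂ : ∀ a b e s t → (a + b + e) + (s + t) ≡ (a + s) + (b + t) + e
  rearrange₂ = solve-∀

Ladder : ℕ → Digraph
Ladder n = P 2 □ P n

v₀ v₁ : Fin n → Fin (size (Ladder n))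
v₀ {n} = combine {2} {n} Fin.zero
v₁ {n} = combine {2} {n} (Fin.suc Fin.zero)

rung : (y : Fin n) → Arc (Ladder n) (v₀ y) (v₁ y)
rung {n} y = □-arc (P 2) (P n) {Fin.zero} {Fin.suc Fin.zero} {y} {y} (inj₁ (refl , refl))

module _ (m : ℕ) where

  private
    L = Ladder (suc m)

  no-arc-into-v₀-zero : ∀ u → ¬ Arc L u (v₀ Fin.zero)
  no-arc-into-v₀-zero u arc with □-in-neighbour (P 2) (P (suc m)) u Fin.zero Fin.zero arc
  ... | _ , _ , _ , inj₁ (() , _)
  ... | _ , _ , _ , inj₂ (_ , ())

  arc-into-v₀-suc : ∀ i {u} → Arc L u (v₀ (Fin.suc i)) → u ≡ v₀ (inject₁ i)
  arc-into-v₀-suc i {u} arc with □-in-neighbour (P 2) (P (suc m)) u Fin.zero (Fin.suc i) arc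
  ... | _ , _ , _    , inj₁ (() , _)
  ... | _ , _ , refl , inj₂ (refl , arc′) = cong v₀ (P-arc⇒≡inject₁ arc′)

  arc-into-v₁-zero : ∀ {u} → Arc L u (v₁ Fin.zero) → u ≡ v₀ Fin.zero
  arc-into-v₁-zero {u} arc with □-in-neighbour (P 2) (P (suc m)) u (Fin.suc Fin.zero) Fin.zero arc
  ... | Fin.zero           , _ , refl , inj₁ (_ , refl) = refl
  ... | Fin.suc Fin.zero   , _ , _    , inj₁ (() , _)
  ... | _                  , _ , _    , inj₂ (_ , ())

  arc-into-v₁-suc : ∀ i {u} → Arc L u (v₁ (Fin.suc i)) → u ≡ v₀ (Fin.suc i) ⊎ u ≡ v₁ (inject₁ i)
  arc-into-v₁-suc i {u} arc with □-in-neighbour (P 2) (P (suc m)) u (Fin.suc Fin.zero) (Fin.suc i) arc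
  ... | Fin.zero           , _ , refl , inj₁ (_ , refl) = inj₁ refl
  ... | Fin.suc Fin.zero   , _ , _    , inj₁ (() , _)
  ... | _                  , _ , refl , inj₂ (refl , arc′) = inj₂ (cong v₁ (P-arc⇒≡inject₁ arc′))

weight-Ladder : ∀ n (f : Labeling (Ladder n) k) →
  weight (Ladder n) k f ≡ sum (tabulate (λ (y : Fin n) → ∣ f (v₀ y) ∣))
                        + sum (tabulate (λ (y : Fin n) → ∣ f (v₁ y) ∣))
weight-Ladder n f = trans (sum-tabulate-combine 2 n (λ v → ∣ f v ∣))
                          (cong (sum (tabulate (λ (y : Fin n) → ∣ f (v₀ y) ∣)) +_) (+-identityʳ _))

rdf-weight-Ladder : ∀ n (f : Labeling (Ladder n) 3) → IsRDF (Ladder n) 3 f → 2 * n ≤ weight (Ladder n) 3 f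
rdf-weight-Ladder zero    f rdf = z≤n
rdf-weight-Ladder (suc m) f rdf = begin
  2 * suc m                                  ≤⟨ columns-bound m α β hα hβ ⟩
  Σα + Σβ + slack (α Fin.zero) (β Fin.zero)  ≡⟨ cong (Σα + Σβ +_) (slack-first _ _ hα₀ hβ₀) ⟩
  Σα + Σβ + 0                                ≡⟨ +-identityʳ _ ⟩
  Σα + Σβ                                    ≡⟨ weight-Ladder (suc m) f ⟨
  weight (Ladder (suc m)) 3 f                ∎
  where
  open ≤-Reasoning
  α β : Fin (suc m) → ℕ
  α y = ∣ f (v₀ y) ∣
  β y = ∣ f (v₁ y) ∣
  Σα = sum (tabulate α)
  Σβ = sum (tabulate β)
  hα₀ : α Fin.zero ≢ 0
  hα₀ = rdf-source (Ladder (suc m)) rdf (no-arc-into-v₀-zero m) Fin.zero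
  hβ₀ : β Fin.zero ≡ 0 → 3 ≤ α Fin.zero
  hβ₀ = rdf-sole-in-neighbour (Ladder (suc m)) rdf (arc-into-v₁-zero m)
  hα : ∀ i → α (Fin.suc i) ≡ 0 → 3 ≤ α (inject₁ i)
  hα i = rdf-sole-in-neighbour (Ladder (suc m)) rdf (arc-into-v₀-suc m i)
  hβ : ∀ i → β (Fin.suc i) ≡ 0 → 3 ≤ α (Fin.suc i) + β (inject₁ i)
  hβ i = rdf-two-in-neighbours (Ladder (suc m)) rdf (arc-into-v₁-suc m i)

module _ {n : ℕ} where

  ⁅0⁆-everywhere : Labeling (Ladder n) 3
  ⁅0⁆-everywhere _ = ⁅ Fin.zero ⁆

  ⁅0⁆-everywhere-isTRDF : IsTRDF (Ladder n) 3 ⁅0⁆-everywhere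
  ⁅0⁆-everywhere-isTRDF = (λ v empty _ → ⊥-elim (empty (labelled v))) , λ v _ →
    subst HasLabelledNeighbour (combine-remQuot {2} n v) (labelled-neighbour (remQuot {2} n v))
    where
    labelled : ∀ v → Nonempty (⁅0⁆-everywhere v)
    labelled _ = Fin.zero , x∈⁅x⁆ Fin.zero
    HasLabelledNeighbour : Fin (size (Ladder n)) → Set
    HasLabelledNeighbour v = ∃ λ u → Nonempty (⁅0⁆-everywhere u) × (Arc (Ladder n) u v ⊎ Arc (Ladder n) v u)
    labelled-neighbour : ∀ ((x , y) : Fin 2 × Fin n) → HasLabelledNeighbour (combine x y)
    labelled-neighbour (Fin.zero         , y) = v₁ y , labelled (v₁ y) , inj₂ (rung y)
    labelled-neighbour (Fin.suc Fin.zero , y) = v₀ y , labelled (v₀ y) , inj₁ (rung y)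

  ⁅0⁆-everywhere-weight : weight (Ladder n) 3 ⁅0⁆-everywhere ≡ 2 * n
  ⁅0⁆-everywhere-weight = trans (sum-tabulate-const (2 * n) 1) (*-identityʳ (2 * n))

proposition4p2 : (n : ℕ) → 2 ≤ n → γtr≡ (P 2 □ P n) 3 (2 * n)
proposition4p2 n _ =
  (⁅0⁆-everywhere {n} , ⁅0⁆-everywhere-isTRDF , ⁅0⁆-everywhere-weight {n}) ,
  λ f trdf → rdf-weight-Ladder n f (proj₁ trdf)
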